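{- Let $n$ and $s$ be integers with $n/3 < s \le n/2$. Then, over integers $t$ with $n - s \le t \le n$, the quantity \[ 2^{n-t} + \sum_{0 \le j \le s}\binom{t}{j} \] is minimised at $t = n-s$. -}

module Defs where

open import Data.Nat using (ℕ; zero; suc; _+_; _∸_; _^_)
open import Data.Nat.Combinatorics using (_C_)

binomSum : ℕ → ℕ → ℕ
binomSum t zero    = t C 0
binomSum t (suc s) = binomSum t s + t C suc s

Q : ℕ → ℕ → ℕ → ℕ
Q n s t = 2 ^ (n ∸ t) + binomSum t s

-- Q n s t is nondecreasing in t on [n − s, n]. By Pascal's rule,
-- Σ_{j≤s} C(t+1, j) = Σ_{j≤s} C(t, j) + Σ_{j≤s−1} C(t, j), so going from t to t + 1
-- the binomial part grows by Σ_{j≤s−1} C(t, j) while the power of two drops by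
-- 2^(n−t−1). As s ≤ n − s ≤ t, that partial sum is at least 2^(s−1) ≥ 2^(n−t−1).
module Submission where

open import Data.Nat using (ℕ; zero; suc; _+_; _*_; _∸_; _^_; _≤_; _<_; s≤s; s≤s⁻¹)
open import Data.Nat.Properties
open import Data.Nat.Combinatorics using (_C_; nCk+nC[k+1]≡[n+1]C[k+1])
open import Data.Nat.Solver using (module +-*-Solver)
open import Data.Sum using (inj₁; inj₂)
open import Relation.Binary.PropositionalEquality
open import Relation.Nullary using (contradiction)

open import Defs

binomSum-suc-suc : ∀ t s → binomSum (suc t) (suc s) ≡ binomSum t (suc s) + binomSum t s
binomSum-suc-suc t zero = begin
  1 + suc t C 1        ≡⟨ cong (1 +_) (nCk+nC[k+1]≡[n+1]C[k+1] t 0) ⟨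
  1 + (1 + t C 1)      ≡⟨ +-comm 1 _ ⟩
  (1 + t C 1) + 1      ∎
  where open ≡-Reasoning
binomSum-suc-suc t (suc s) = begin
  binomSum (suc t) (suc s) + suc t C suc (suc s)
    ≡⟨ cong₂ _+_ (binomSum-suc-suc t s) (sym (nCk+nC[k+1]≡[n+1]C[k+1] t (suc s))) ⟩
  binomSum t (suc s) + binomSum t s + (t C suc s + t C suc (suc s))
    ≡⟨ solve 4 (λ a b c d → a :+ b :+ (c :+ d) := a :+ d :+ (b :+ c)) refl
         (binomSum t (suc s)) (binomSum t s) (t C suc s) (t C suc (suc s)) ⟩
  binomSum t (suc s) + t C suc (suc s) + (binomSum t s + t C suc s)
    ∎
  where open ≡-Reasoning; open +-*-Solver

2^s≤binomSum : ∀ {t s} → s ≤ t → 2 ^ s ≤ binomSum t s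
2^s≤binomSum {t}     {zero}  _         = ≤-refl
2^s≤binomSum {suc t} {suc s} (s≤s s≤t) = begin
  2 ^ s + (2 ^ s + 0)                ≡⟨ cong (2 ^ s +_) (+-identityʳ _) ⟩
  2 ^ s + 2 ^ s                      ≤⟨ +-mono-≤ (≤-trans 2^s≤ (m≤m+n _ _)) 2^s≤ ⟩
  binomSum t (suc s) + binomSum t s  ≡⟨ binomSum-suc-suc t s ⟨
  binomSum (suc t) (suc s)           ∎
  where
  open ≤-Reasoning
  2^s≤ : 2 ^ s ≤ binomSum t s
  2^s≤ = 2^s≤binomSum s≤t

2^[1+j]+binomSum≤2^j+binomSum-suc : ∀ {j s t} → j ≤ s → s ≤ t →
  2 ^ suc j + binomSum t (suc s) ≤ 2 ^ j + binomSum (suc t) (suc s)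
2^[1+j]+binomSum≤2^j+binomSum-suc {j} {s} {t} j≤s s≤t = begin
  2 ^ j + (2 ^ j + 0) + binomSum t (suc s)
    ≡⟨ cong (λ k → 2 ^ j + k + binomSum t (suc s)) (+-identityʳ _) ⟩
  2 ^ j + 2 ^ j + binomSum t (suc s)
    ≤⟨ +-monoˡ-≤ _ (+-monoʳ-≤ (2 ^ j) (≤-trans (^-monoʳ-≤ 2 j≤s) (2^s≤binomSum s≤t))) ⟩
  2 ^ j + binomSum t s + binomSum t (suc s)
    ≡⟨ +-assoc (2 ^ j) _ _ ⟩
  2 ^ j + (binomSum t s + binomSum t (suc s))
    ≡⟨ cong (2 ^ j +_) (trans (+-comm (binomSum t s) _) (sym (binomSum-suc-suc t s))) ⟩
  2 ^ j + binomSum (suc t) (suc s)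
    ∎
  where open ≤-Reasoning

Q-step : ∀ {n s t} → n ∸ t ≤ s → s ≤ suc t → t < n → Q n s t ≤ Q n s (suc t)
Q-step {n} {zero}  {t} n∸t≤0 _ t<n = contradiction n∸t≤0 (<⇒≱ (m<n⇒0<n∸m t<n))
Q-step {n} {suc s} {t} n∸t≤1+s (s≤s s≤t) t<n = begin
  2 ^ (n ∸ t) + binomSum t (suc s)
    ≡⟨ cong (λ k → 2 ^ k + binomSum t (suc s)) n∸t≡1+n∸[1+t] ⟩
  2 ^ suc (n ∸ suc t) + binomSum t (suc s)
    ≤⟨ 2^[1+j]+binomSum≤2^j+binomSum-suc
         (s≤s⁻¹ (subst (_≤ suc s) n∸t≡1+n∸[1+t] n∸t≤1+s)) s≤t ⟩
  2 ^ (n ∸ suc t) + binomSum (suc t) (suc s)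
    ∎
  where
  open ≤-Reasoning
  n∸t≡1+n∸[1+t] : n ∸ t ≡ suc (n ∸ suc t)
  n∸t≡1+n∸[1+t] = +-∸-assoc 1 t<n

step-≤⇒mono-≤ : ∀ {f : ℕ → ℕ} {a b} → (∀ {u} → a ≤ u → u < b → f u ≤ f (suc u)) →
  ∀ {t} → a ≤ t → t ≤ b → f a ≤ f t
step-≤⇒mono-≤ step {zero} a≤t t≤b rewrite n≤0⇒n≡0 a≤t = ≤-refl
step-≤⇒mono-≤ step {suc t} a≤1+t 1+t≤b with m≤n⇒m<n∨m≡n a≤1+t
... | inj₁ (s≤s a≤t) = ≤-trans (step-≤⇒mono-≤ step a≤t (<⇒≤ 1+t≤b)) (step a≤t 1+t≤b)
... | inj₂ refl      = ≤-refl

Q-mono : ∀ {n s t} → s ≤ n ∸ s → n ∸ s ≤ t → t ≤ n → Q n s (n ∸ s) ≤ Q n s t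
Q-mono {n} {s} s≤n∸s = step-≤⇒mono-≤ λ {u} n∸s≤u u<n →
  Q-step (n∸u≤s n∸s≤u) (m≤n⇒m≤1+n (≤-trans s≤n∸s n∸s≤u)) u<n
  where
  n∸u≤s : ∀ {u} → n ∸ s ≤ u → n ∸ u ≤ s
  n∸u≤s {u} n∸s≤u = m≤n+o⇒m∸n≤o n u (begin
    n            ≤⟨ m≤n+m∸n n s ⟩
    s + (n ∸ s)  ≤⟨ +-monoʳ-≤ s n∸s≤u ⟩
    s + u        ≡⟨ +-comm s u ⟩
    u + s        ∎)
    where open ≤-Reasoning

lemma4p2 : (n s : ℕ) → n < 3 * s → 2 * s ≤ n →
    (t : ℕ) → n ∸ s ≤ t → t ≤ n → Q n s (n ∸ s) ≤ Q n s t
lemma4p2 n s _ 2s≤n t = Q-mono s≤n∸s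
  where
  s≤n∸s : s ≤ n ∸ s
  s≤n∸s = m+n≤o⇒m≤o∸n s (subst (_≤ n) (cong (s +_) (+-identityʳ s)) 2s≤n)
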